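{- Let $P$ be a path producible by a tile assembly system $\mathcal T=(T,\sigma,1)$ such that the last tile of $P$ is the unique easternmost tile of $\sigma\cup P$. Then either (a) all glues of $P$ visible from the north relative to $P$ point to the east, or (b) all glues of $P$ visible from the south relative to $P$ point to the east.
   Context: Temperature-1 aTAM: tile types are unit squares with a glue on each side; adjacent tiles interact if their abutting glues are equal with strength $\ge 1$; a system $\mathcal T=(T,\sigma,1)$ grows from seed assembly $\sigma$ by attaching single tiles that interact with at least one neighbour. A path is a sequence of tiles $P_m=(\mathrm{pos}(P_m),t_m)$, $\mathrm{pos}(P_m)\in\mathbb Z^2$, with pairwise distinct positions, consecutive positions grid-adjacent and consecutive tiles interacting; it is producible if it avoids the positions of $\sigma$, $P_0$ interacts with a tile of $\sigma$, and $\sigma\cup P$ is a producible assembly. The glue $g_m$ of $P$ is the glue shared by $P_m$ and $P_{m+1}$, located at the midpoint of their positions, pointing east/west/north/south according to $\mathrm{pos}(P_{m+1})-\mathrm{pos}(P_m)$. The embedding of $P$ is the polygonal curve through its positions in order. A glue $g_m$ pointing east or west is visible from the south (resp. north) relative to $P$ if the vertical ray to the south (resp. north) starting at $\big((x(P_m)+x(P_{m+1}))/2,\,y(P_m)\big)$ intersects neither the embedding of $P$ nor $\sigma$ (including segments between adjacent seed tiles). -}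

module Defs where

open import Data.Nat using (ℕ; zero; suc; _≥_)
open import Data.Integer as ℤ using (ℤ; +_)
import Data.Integer.Properties as ℤP
open import Data.Rational as ℚ using (ℚ; ½; 0ℚ; 1ℚ)
open import Data.Fin using (Fin; zero; suc; inject₁; fromℕ)
open import Data.Product using (Σ; ∃; ∃-syntax; _×_; _,_; proj₁; proj₂)
open import Data.Product.Properties using (≡-dec)
open import Data.Sum using (_⊎_)
open import Data.Maybe using (Maybe; just; nothing)
open import Data.List using (List)
open import Data.List.Membership.Propositional using (_∈_)
open import Relation.Nullary using (¬_; yes; no)
open import Relation.Binary.PropositionalEquality using (_≡_; _≢_)
open import Function.Definitions using (Injective)

record Glue : Set where
  constructor glue
  field
    label    : ℕ
    strength : ℕ
open Glue public

record TileType : Set where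
  constructor tile
  field
    northG eastG southG westG : Glue
open TileType public

data Dir : Set where
  N E S W : Dir

opp : Dir → Dir
opp N = S
opp S = N
opp E = W
opp W = E

glueOn : TileType → Dir → Glue
glueOn t N = northG t
glueOn t E = eastG t
glueOn t S = southG t
glueOn t W = westG t

Pos : Set
Pos = ℤ × ℤ

xc yc : Pos → ℤ
xc = proj₁
yc = proj₂

move : Pos → Dir → Pos
move (x , y) N = (x , y ℤ.+ + 1)
move (x , y) S = (x , y ℤ.- + 1)
move (x , y) E = (x ℤ.+ + 1 , y)
move (x , y) W = (x ℤ.- + 1 , y)

_≟Pos_ : (p q : Pos) → Relation.Nullary.Dec (p ≡ q)
_≟Pos_ = ≡-dec ℤ._≟_ ℤ._≟_

Interacts : TileType → Dir → TileType → Set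
Interacts t d u = (glueOn t d ≡ glueOn u (opp d)) × (strength (glueOn t d) ≥ 1)

Assembly : Set
Assembly = Pos → Maybe TileType

Finite : Assembly → Set
Finite α = Σ (List Pos) λ xs → ∀ p t → α p ≡ just t → p ∈ xs

update : Assembly → Pos → TileType → Assembly
update α p t q with q ≟Pos p
... | yes _ = just t
... | no  _ = α q

record TAS : Set where
  field
    T        : List TileType
    σ        : Assembly
    σ-finite : Finite σ
open TAS public

data Producible (𝒯 : TAS) : Assembly → Set where
  seed   : ∀ {α} → (∀ q → α q ≡ σ 𝒯 q) → Producible 𝒯 α
  attach : ∀ {α β} p t d u →
           Producible 𝒯 α → α p ≡ nothing → t ∈ T 𝒯 →
           α (move p d) ≡ just u → Interacts t d u →
           (∀ q → β q ≡ update α p t q) → Producible 𝒯 β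

-- Paths: n+1 tiles P_0 … P_n, glues g_0 … g_{n-1}

record Path (n : ℕ) : Set where
  field
    pos  : Fin (suc n) → Pos
    tt   : Fin (suc n) → TileType
    dir  : Fin n → Dir
    distinct : Injective _≡_ _≡_ pos
    adjacent : ∀ m → pos (suc m) ≡ move (pos (inject₁ m)) (dir m)
    interact : ∀ m → Interacts (tt (inject₁ m)) (dir m) (tt (suc m))
open Path public

lastIx : ∀ {n} → Fin (suc n)
lastIx {n} = fromℕ n

findPos : ∀ {k} → (Fin k → Pos) → (Fin k → TileType) → Pos → Maybe TileType
findPos {zero}  f g q = nothing
findPos {suc k} f g q with f zero ≟Pos q
... | yes _ = just (g zero)
... | no  _ = findPos (λ i → f (suc i)) (λ i → g (suc i)) q

_∪P_ : ∀ {n} → Assembly → Path n → Assembly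
(σ' ∪P P) q with findPos (pos P) (tt P) q
... | just t  = just t
... | nothing = σ' q

record ProduciblePath (𝒯 : TAS) {n : ℕ} (P : Path n) : Set where
  field
    avoids    : ∀ i → σ 𝒯 (pos P i) ≡ nothing
    attached  : Σ Dir λ d → Σ TileType λ s →
                (σ 𝒯 (move (pos P zero) d) ≡ just s) × Interacts (tt P zero) d s
    producible : Producible 𝒯 (σ 𝒯 ∪P P)

PointsEast : ∀ {n} → Path n → Fin n → Set
PointsEast P m = dir P m ≡ E

Horizontal : ∀ {n} → Path n → Fin n → Set
Horizontal P m = (dir P m ≡ E) ⊎ (dir P m ≡ W)

Point : Set
Point = ℚ × ℚ

toℚ : ℤ → ℚ
toℚ z = z ℚ./ 1

embed : Pos → Point
embed (x , y) = (toℚ x , toℚ y)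

OnSegment : Point → Point → Point → Set
OnSegment (rx , ry) (ax , ay) (bx , by) =
  Σ ℚ λ l → (0ℚ ℚ.≤ l) × (l ℚ.≤ 1ℚ) ×
    (rx ≡ ax ℚ.+ l ℚ.* (bx ℚ.- ax)) × (ry ≡ ay ℚ.+ l ℚ.* (by ℚ.- ay))

OnEmbedding : ∀ {n} → Path n → Point → Set
OnEmbedding P r =
  (Σ _ λ i → r ≡ embed (pos P i)) ⊎
  (Σ _ λ m → OnSegment r (embed (pos P (inject₁ m))) (embed (pos P (suc m))))

OnSeed : Assembly → Point → Set
OnSeed σ' r =
  (Σ Pos λ q → Σ TileType λ s → (σ' q ≡ just s) × (r ≡ embed q)) ⊎
  (Σ Pos λ q → Σ Dir λ d → Σ TileType λ s → Σ TileType λ s' →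
     (σ' q ≡ just s) × (σ' (move q d) ≡ just s') ×
     OnSegment r (embed q) (embed (move q d)))

rayStart : ∀ {n} → Path n → Fin n → Point
rayStart P m =
  ( (toℚ (xc (pos P (inject₁ m))) ℚ.+ toℚ (xc (pos P (suc m)))) ℚ.* ½
  , toℚ (yc (pos P (inject₁ m))) )

VisibleNorth VisibleSouth : ∀ {n} → Assembly → Path n → Fin n → Set
VisibleNorth σ' P m = let (a , b) = rayStart P m in
  ¬ (Σ ℚ λ t → (0ℚ ℚ.< t) ×
       (OnEmbedding P (a , b ℚ.+ t) ⊎ OnSeed σ' (a , b ℚ.+ t)))
VisibleSouth σ' P m = let (a , b) = rayStart P m in
  ¬ (Σ ℚ λ t → (0ℚ ℚ.< t) ×
       (OnEmbedding P (a , b ℚ.- t) ⊎ OnSeed σ' (a , b ℚ.- t)))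

LastUniqueEasternmost : ∀ {n} → Assembly → Path n → Set
LastUniqueEasternmost σ' P =
  ∀ q t → (σ' ∪P P) q ≡ just t → q ≢ pos P lastIx →
  xc q ℤ.< xc (pos P lastIx)

-- Suppose a west-pointing glue g_m is visible from the north and a west-pointing glue g_k from
-- the south; reflecting in the x-axis if necessary, k ≤ m.  Let Q be the part of P after g_m and,
-- for a tile P_i, count modulo 2 the crossings of Q with the open ray going south from the point
-- half a unit west of P_i.  At P_m this parity is 1: Q starts just west of the ray's vertical line,
-- ends strictly east of it (the last tile is the easternmost one), and never crosses it above P_m
-- because g_m is visible from the north.  At P_k it is 0 because g_k is visible from the south.
-- Yet it is the same at P_i and P_{i+1} for k ≤ i < m: Q avoids both tiles, and moving the ray
-- one column east changes the parity only by the endpoints of Q lying below in that column; the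
-- end of Q is east of everything, and the start of Q could only lie there if the step from P_i
-- to P_{i+1} crossed the north ray of g_m.

module Submission where

open import Defs
open import Algebra.Bundles using (CommutativeRing)
open import Data.Bool as Bool using (Bool; true; false; _∧_; _xor_)
open import Data.Bool.Properties
  using (xor-same; xor-comm; xor-assoc; ∧-distribʳ-xor; ∧-distribˡ-xor; xor-∧-commutativeRing; ¬-not)
open import Data.Empty using (⊥; ⊥-elim)
open import Data.Fin using (Fin; zero; suc; toℕ; fromℕ<; inject₁)
import Data.Fin.Properties as FinP
open import Data.Integer as ℤ using (ℤ; 1ℤ)
import Data.Integer.Properties as ℤP
open import Data.Maybe using (just; nothing)
open import Data.Nat as ℕ using (ℕ; zero; suc)
import Data.Nat.Properties as ℕP
open import Data.Rational as ℚ using (ℚ; ½; 0ℚ)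
import Data.Rational.Properties as ℚP
import Data.Rational.Solver
import Data.Rational.Unnormalised as ℚᵘ
import Data.Rational.Unnormalised.Properties as ℚᵘP
open import Data.Product using (Σ; _×_; _,_; proj₁; proj₂)
open import Data.Sum using (_⊎_; inj₁; inj₂)
open import Function using (_∘_)
open import Function.Bundles using (mk⇔)
open import Relation.Nullary using (¬_; Dec; yes; no; does; ¬?; _×-dec_)
open import Relation.Nullary.Decidable using (dec-true; dec-false; does-⇔; decidable-stable)
open import Relation.Binary.PropositionalEquality
open import Algebra.Properties.CommutativeSemigroup
  (CommutativeRing.+-commutativeSemigroup xor-∧-commutativeRing) using (interchange)

open ≡-Reasoning

xor-true⇒≢ : ∀ {a b} → a xor b ≡ true → a ≢ b
xor-true⇒≢ {a} c refl with () ← trans (sym c) (xor-same a)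

xor-false⇒≡ : ∀ {a b} → a xor b ≡ false → a ≡ b
xor-false⇒≡ {false} {false} _ = refl
xor-false⇒≡ {true}  {true}  _ = refl

∧-true : ∀ {a b} → a ∧ b ≡ true → a ≡ true × b ≡ true
∧-true {true} {true} _ = refl , refl

∧-xor-interchange : ∀ p q r t s →
  ((p xor q) ∧ s) xor ((r xor t) ∧ s) ≡ ((p xor r) ∧ s) xor ((q xor t) ∧ s)
∧-xor-interchange p q r t s = begin
  ((p xor q) ∧ s) xor ((r xor t) ∧ s)  ≡⟨ ∧-distribʳ-xor s (p xor q) (r xor t) ⟨
  ((p xor q) xor (r xor t)) ∧ s        ≡⟨ cong (_∧ s) (interchange p q r t) ⟩
  ((p xor r) xor (q xor t)) ∧ s        ≡⟨ ∧-distribʳ-xor s (p xor r) (q xor t) ⟩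
  ((p xor r) ∧ s) xor ((q xor t) ∧ s)  ∎

parity : (ℕ → Bool) → ℕ → Bool
parity b zero    = false
parity b (suc l) = parity b l xor b l

parity-cong : ∀ {b b′ : ℕ → Bool} l → (∀ {j} → j ℕ.< l → b j ≡ b′ j) →
  parity b l ≡ parity b′ l
parity-cong zero    _  = refl
parity-cong (suc l) eq = cong₂ _xor_ (parity-cong l (eq ∘ ℕP.m<n⇒m<1+n)) (eq ℕP.≤-refl)

parity-false : ∀ {b : ℕ → Bool} l → (∀ {j} → j ℕ.< l → b j ≡ false) → parity b l ≡ false
parity-false zero    _  = refl
parity-false (suc l) eq = cong₂ _xor_ (parity-false l (eq ∘ ℕP.m<n⇒m<1+n)) (eq ℕP.≤-refl)

parity-xor : ∀ (b b′ : ℕ → Bool) l → parity (λ j → b j xor b′ j) l ≡ parity b l xor parity b′ l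
parity-xor b b′ zero    = refl
parity-xor b b′ (suc l) = trans (cong (_xor (b l xor b′ l)) (parity-xor b b′ l))
                                (interchange (parity b l) (parity b′ l) (b l) (b′ l))

parity-telescope : ∀ (b : ℕ → Bool) l → parity (λ j → b j xor b (suc j)) l ≡ b 0 xor b l
parity-telescope b zero    = sym (xor-same (b 0))
parity-telescope b (suc l) = begin
  parity (λ j → b j xor b (suc j)) l xor (b l xor b (suc l))
    ≡⟨ cong (_xor (b l xor b (suc l))) (parity-telescope b l) ⟩
  (b 0 xor b l) xor (b l xor b (suc l))
    ≡⟨ xor-assoc (b 0) (b l) (b l xor b (suc l)) ⟩
  b 0 xor (b l xor (b l xor b (suc l)))
    ≡⟨ cong (b 0 xor_) (xor-assoc (b l) (b l) (b (suc l))) ⟨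
  b 0 xor ((b l xor b l) xor b (suc l))
    ≡⟨ cong (λ z → b 0 xor (z xor b (suc l))) (xor-same (b l)) ⟩
  b 0 xor b (suc l) ∎

infix 5 _<ᵇ_
_<ᵇ_ : ℤ → ℤ → Bool
i <ᵇ j = does (i ℤ.<? j)

<ᵇ⇒< : ∀ {i j} → i <ᵇ j ≡ true → i ℤ.< j
<ᵇ⇒< {i} {j} _ with i ℤ.<? j
... | yes i<j = i<j

i-1+1≡i : ∀ i → i ℤ.- 1ℤ ℤ.+ 1ℤ ≡ i
i-1+1≡i i = trans (ℤP.+-assoc i (ℤ.- 1ℤ) 1ℤ) (ℤP.+-identityʳ i)

i+1-1≡i : ∀ i → i ℤ.+ 1ℤ ℤ.- 1ℤ ≡ i
i+1-1≡i i = trans (ℤP.+-assoc i 1ℤ (ℤ.- 1ℤ)) (ℤP.+-identityʳ i)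

i<i+1 : ∀ i → i ℤ.< i ℤ.+ 1ℤ
i<i+1 i = ℤP.suc[i]≤j⇒i<j (ℤP.≤-reflexive (ℤP.+-comm 1ℤ i))

i-1<i : ∀ i → i ℤ.- 1ℤ ℤ.< i
i-1<i i = subst (i ℤ.- 1ℤ ℤ.<_) (i-1+1≡i i) (i<i+1 (i ℤ.- 1ℤ))

i<j⇒i+1≤j : ∀ {i j} → i ℤ.< j → i ℤ.+ 1ℤ ℤ.≤ j
i<j⇒i+1≤j {i} i<j = subst (ℤ._≤ _) (ℤP.+-comm 1ℤ i) (ℤP.i<j⇒suc[i]≤j i<j)

<ᵇ-+1ˡ : ∀ {i j} → i ℤ.+ 1ℤ ≢ j → (i ℤ.+ 1ℤ <ᵇ j) ≡ (i <ᵇ j)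
<ᵇ-+1ˡ {i} {j} i+1≢j = does-⇔
  (mk⇔ (ℤP.<-trans (i<i+1 i)) (λ i<j → ℤP.≤∧≢⇒< (i<j⇒i+1≤j i<j) i+1≢j))
  (i ℤ.+ 1ℤ ℤ.<? j) (i ℤ.<? j)

<ᵇ-+1ʳ : ∀ {i j} → i ≢ j → (i <ᵇ j ℤ.+ 1ℤ) ≡ (i <ᵇ j)
<ᵇ-+1ʳ {i} {j} i≢j = does-⇔ (mk⇔ i<j+1⇒i<j (λ i<j → ℤP.<-trans i<j (i<i+1 j)))
  (i ℤ.<? j ℤ.+ 1ℤ) (i ℤ.<? j)
  where
  i<j+1⇒i<j : i ℤ.< j ℤ.+ 1ℤ → i ℤ.< j
  i<j+1⇒i<j i<j+1 =
    ℤP.≤∧≢⇒< (ℤP.≮⇒≥ λ j<i → ℤP.<-irrefl refl (ℤP.<-≤-trans i<j+1 (i<j⇒i+1≤j j<i)))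
             i≢j

xor-<ᵇ-+1 : ∀ {i j h} → j ≡ i ℤ.+ 1ℤ → (i <ᵇ h) xor (j <ᵇ h) ≡ true → j ≡ h
xor-<ᵇ-+1 {i} {h = h} refl c =
  decidable-stable (i ℤ.+ 1ℤ ℤ.≟ h) λ i+1≢h → xor-true⇒≢ c (sym (<ᵇ-+1ˡ {i} i+1≢h))

xor-<ᵇ-+1ʳ : ∀ {i h} → (i <ᵇ h) xor (i <ᵇ h ℤ.+ 1ℤ) ≡ true → i ≡ h
xor-<ᵇ-+1ʳ {i} {h} c = decidable-stable (i ℤ.≟ h) λ i≢h → xor-true⇒≢ c (sym (<ᵇ-+1ʳ i≢h))

UnitStep : Pos → Pos → Set
UnitStep u v = Σ Dir λ d → v ≡ move u d

-- Lines and rays are indexed by lattice points: crosses h says that a step crosses the vertical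
-- line x = h - ½, and crossesBelow (h , y) that it crosses the open ray going south from
-- (h - ½ , y).  For a west-pointing glue g_m this is its south ray, indexed by P_m.
crosses : ℤ → Pos → Pos → Bool
crosses h (x , _) (x′ , _) = (x <ᵇ h) xor (x′ <ᵇ h)

data Crossing (h : ℤ) : Pos → Pos → Set where
  eastward : ∀ {x y} → x ℤ.+ 1ℤ ≡ h → Crossing h (x , y) (x ℤ.+ 1ℤ , y)
  westward : ∀ {x y} → x ≡ h → Crossing h (x , y) (x ℤ.- 1ℤ , y)

crosses-sound : ∀ {h u v} → UnitStep u v → crosses h u v ≡ true → Crossing h u v
crosses-sound {h} {u = x , _} (N , refl) c = ⊥-elim (xor-true⇒≢ {x <ᵇ h} c refl)
crosses-sound {h} {u = x , _} (S , refl) c = ⊥-elim (xor-true⇒≢ {x <ᵇ h} c refl)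
crosses-sound {u = x , _} (E , refl) c = eastward (xor-<ᵇ-+1 {x} refl c)
crosses-sound {h} {u = x , _} (W , refl) c = westward
  (xor-<ᵇ-+1 {x ℤ.- 1ℤ} (sym (i-1+1≡i x)) (trans (xor-comm (x ℤ.- 1ℤ <ᵇ h) (x <ᵇ h)) c))

crosses-complete : ∀ {h u v} → Crossing h u v → crosses h u v ≡ true
crosses-complete (eastward {x} refl) = cong₂ _xor_
  (dec-true (x ℤ.<? x ℤ.+ 1ℤ) (i<i+1 x)) (dec-false (x ℤ.+ 1ℤ ℤ.<? x ℤ.+ 1ℤ) (ℤP.<-irrefl refl))
crosses-complete (westward {x} refl) = cong₂ _xor_
  (dec-false (x ℤ.<? x) (ℤP.<-irrefl refl)) (dec-true (x ℤ.- 1ℤ ℤ.<? x) (i-1<i x))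

crossing-height : ∀ {h y u v} → Crossing h u v → u ≢ (h , y) → v ≢ (h , y) → yc u ≢ y
crossing-height (eastward x+1≡h) _   v≢c refl = v≢c (cong (_, _) x+1≡h)
crossing-height (westward x≡h)   u≢c _   refl = u≢c (cong (_, _) x≡h)

crossesBelow : Pos → Pos → Pos → Bool
crossesBelow (h , y) u v = crosses h u v ∧ (yc u <ᵇ y)

-- p lies in the column of c, strictly south of c.  The column is written through its two
-- bounding lines so that, on horizontal steps, crossesBelow-east is pure xor algebra.
below : Pos → Pos → Bool
below (x , y) (x′ , y′) = ((x′ <ᵇ x) xor (x′ <ᵇ x ℤ.+ 1ℤ)) ∧ (y′ <ᵇ y)

below-sound : ∀ {c p} → below c p ≡ true → xc p ≡ xc c × yc p ℤ.< yc c
below-sound b = let column , lower = ∧-true b in xor-<ᵇ-+1ʳ column , <ᵇ⇒< lower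

below-vertical : ∀ {x y x′ y₀ y₁} → y₁ ≡ y₀ ℤ.+ 1ℤ →
  below (x , y) (x′ , y₀) xor below (x , y) (x′ , y₁) ≡ true → (x′ , y₁) ≡ (x , y)
below-vertical {x} {y} {x′} {y₀} {y₁} y₁≡y₀+1 b =
  let in-column = (x′ <ᵇ x) xor (x′ <ᵇ x ℤ.+ 1ℤ)
      column , level = ∧-true (trans (∧-distribˡ-xor in-column (y₀ <ᵇ y) (y₁ <ᵇ y)) b)
  in cong₂ _,_ (xor-<ᵇ-+1ʳ column) (xor-<ᵇ-+1 {y₀} y₁≡y₀+1 level)

crossesBelow-north : ∀ {x y u v} → UnitStep u v → u ≢ (x , y) → v ≢ (x , y) →
  crossesBelow (x , y ℤ.+ 1ℤ) u v ≡ crossesBelow (x , y) u v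
crossesBelow-north {x} {u = u} {v} st u≢c v≢c with crosses x u v in c
... | false = refl
... | true  = <ᵇ-+1ʳ (crossing-height (crosses-sound st c) u≢c v≢c)

crossesBelow-unblocked : ∀ {h y u v} → UnitStep u v → u ≢ (h , y) → v ≢ (h , y) →
  (crosses h u v ≡ true → ¬ y ℤ.< yc u) → crossesBelow (h , y) u v ≡ crosses h u v
crossesBelow-unblocked {h} {y} {u} {v} st u≢c v≢c unblocked with crosses h u v in c
... | false = refl
... | true  = dec-true (yc u ℤ.<? y)
  (ℤP.≤∧≢⇒< (ℤP.≮⇒≥ (unblocked refl)) (crossing-height (crosses-sound st c) u≢c v≢c))

crossesBelow-clear : ∀ {h y u v} → (crosses h u v ≡ true → ¬ yc u ℤ.< y) →
  crossesBelow (h , y) u v ≡ false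
crossesBelow-clear {h} {y} {u} {v} clear with crosses h u v in c
... | false = refl
... | true  = dec-false (yc u ℤ.<? y) (clear refl)

crossesBelow-east : ∀ {x y u v} → UnitStep u v → u ≢ (x , y) → v ≢ (x , y) →
  crossesBelow (x , y) u v xor crossesBelow (x ℤ.+ 1ℤ , y) u v ≡ below (x , y) u xor below (x , y) v
crossesBelow-east {x} {y} {u₁ , u₂} (E , refl) _ _ = ∧-xor-interchange
  (u₁ <ᵇ x) (u₁ ℤ.+ 1ℤ <ᵇ x) (u₁ <ᵇ x ℤ.+ 1ℤ) (u₁ ℤ.+ 1ℤ <ᵇ x ℤ.+ 1ℤ) (u₂ <ᵇ y)
crossesBelow-east {x} {y} {u₁ , u₂} (W , refl) _ _ = ∧-xor-interchange
  (u₁ <ᵇ x) (u₁ ℤ.- 1ℤ <ᵇ x) (u₁ <ᵇ x ℤ.+ 1ℤ) (u₁ ℤ.- 1ℤ <ᵇ x ℤ.+ 1ℤ) (u₂ <ᵇ y)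
crossesBelow-east {x} {y} {u₁ , u₂} (N , refl) _ v≢c
  rewrite xor-same (u₁ <ᵇ x) | xor-same (u₁ <ᵇ x ℤ.+ 1ℤ)
  with below (x , y) (u₁ , u₂) xor below (x , y) (u₁ , u₂ ℤ.+ 1ℤ) in b
... | false = refl
... | true  = ⊥-elim (v≢c (below-vertical {y₀ = u₂} refl b))
crossesBelow-east {x} {y} {u₁ , u₂} (S , refl) u≢c _
  rewrite xor-same (u₁ <ᵇ x) | xor-same (u₁ <ᵇ x ℤ.+ 1ℤ)
  with below (x , y) (u₁ , u₂) xor below (x , y) (u₁ , u₂ ℤ.- 1ℤ) in b
... | false = refl
... | true  = ⊥-elim (u≢c (below-vertical {y₀ = u₂ ℤ.- 1ℤ} (sym (i-1+1≡i u₂))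
  (trans (xor-comm (below (x , y) (u₁ , u₂ ℤ.- 1ℤ)) (below (x , y) (u₁ , u₂))) b)))

module RayParity (l : ℕ) (q : ℕ → Pos) (step : ∀ {j} → j ℕ.< l → UnitStep (q j) (q (suc j))) where

  rayParity : Pos → Bool
  rayParity c = parity (λ j → crossesBelow c (q j) (q (suc j))) l

  Avoids : Pos → Set
  Avoids c = ∀ {j} → j ℕ.≤ l → q j ≢ c

  rayParity-north : ∀ {x y} → Avoids (x , y) → rayParity (x , y ℤ.+ 1ℤ) ≡ rayParity (x , y)
  rayParity-north avoids =
    parity-cong l λ j<l → crossesBelow-north (step j<l) (avoids (ℕP.<⇒≤ j<l)) (avoids j<l)

  rayParity-east : ∀ {x y} → Avoids (x , y) →
    rayParity (x , y) xor rayParity (x ℤ.+ 1ℤ , y) ≡ below (x , y) (q 0) xor below (x , y) (q l)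
  rayParity-east {x} {y} avoids = begin
    rayParity (x , y) xor rayParity (x ℤ.+ 1ℤ , y)
      ≡⟨ parity-xor (λ j → crossesBelow (x , y) (q j) (q (suc j)))
                    (λ j → crossesBelow (x ℤ.+ 1ℤ , y) (q j) (q (suc j))) l ⟨
    parity (λ j → crossesBelow (x , y) (q j) (q (suc j))
                  xor crossesBelow (x ℤ.+ 1ℤ , y) (q j) (q (suc j))) l
      ≡⟨ parity-cong l (λ j<l → crossesBelow-east (step j<l) (avoids (ℕP.<⇒≤ j<l)) (avoids j<l)) ⟩
    parity (λ j → below (x , y) (q j) xor below (x , y) (q (suc j))) l
      ≡⟨ parity-telescope (λ j → below (x , y) (q j)) l ⟩
    below (x , y) (q 0) xor below (x , y) (q l) ∎

  rayParity-unblocked : ∀ {h y} → Avoids (h , y) →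
    (∀ {j} → j ℕ.< l → crosses h (q j) (q (suc j)) ≡ true → ¬ y ℤ.< yc (q j)) →
    rayParity (h , y) ≡ (xc (q 0) <ᵇ h) xor (xc (q l) <ᵇ h)
  rayParity-unblocked {h} avoids unblocked = trans
    (parity-cong l λ j<l →
      crossesBelow-unblocked (step j<l) (avoids (ℕP.<⇒≤ j<l)) (avoids j<l) (unblocked j<l))
    (parity-telescope (λ j → xc (q j) <ᵇ h) l)

  rayParity-clear : ∀ {h y} →
    (∀ {j} → j ℕ.< l → crosses h (q j) (q (suc j)) ≡ true → ¬ yc (q j) ℤ.< y) →
    rayParity (h , y) ≡ false
  rayParity-clear {h} {y} clear =
    parity-false l λ {j} j<l → crossesBelow-clear {h} {y} {q j} {q (suc j)} (clear j<l)

-- move computes only on positions that are syntactically pairs.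
move-η : ∀ p d → move p d ≡ move (xc p , yc p) d
move-η (_ , _) _ = refl

record EastwardWalk : Set where
  field
    len       : ℕ
    at        : ℕ → Pos
    step      : ∀ {j} → j ℕ.< len → UnitStep (at j) (at (suc j))
    injective : ∀ {i j} → i ℕ.≤ len → j ℕ.≤ len → at i ≡ at j → i ≡ j
    east      : ∀ {i} → i ℕ.< len → xc (at i) ℤ.< xc (at len)

  WestStep : ℕ → Set
  WestStep m = at (suc m) ≡ move (at m) W

  -- When the step at m points west, these say that step j meets the north or south ray of it.
  BlocksNorth BlocksSouth : ℕ → ℕ → Set
  BlocksNorth m j = crosses (xc (at m)) (at j) (at (suc j)) ≡ true × yc (at m) ℤ.< yc (at j)
  BlocksSouth m j = crosses (xc (at m)) (at j) (at (suc j)) ≡ true × yc (at j) ℤ.< yc (at m)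

  NorthClear SouthClear : ℕ → Set
  NorthClear m = ∀ {j} → j ℕ.< len → ¬ BlocksNorth m j
  SouthClear m = ∀ {j} → j ℕ.< len → ¬ BlocksSouth m j

  westStep? : ∀ m → Dec (WestStep m)
  westStep? m = at (suc m) ≟Pos move (at m) W

  northClear? : ∀ m → Dec (NorthClear m)
  northClear? m = ℕP.allUpTo? (λ j → ¬? ((crosses (xc (at m)) (at j) (at (suc j)) Bool.≟ true)
                                          ×-dec (yc (at m) ℤ.<? yc (at j)))) len

module _ (w : EastwardWalk) where
  open EastwardWalk w

  module AfterWestStep {m} (m<n : m ℕ.< len) (west : WestStep m) (clear : NorthClear m) where

    s l : ℕ
    s = suc m
    l = len ℕ.∸ s

    shift-≤ : ∀ {j} → j ℕ.≤ l → j ℕ.+ s ℕ.≤ len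
    shift-≤ {j} j≤l = subst (j ℕ.+ s ℕ.≤_) (ℕP.m∸n+n≡m m<n) (ℕP.+-monoˡ-≤ s j≤l)

    rest : ℕ → Pos
    rest j = at (j ℕ.+ s)

    open RayParity l rest (step ∘ shift-≤)

    rest-start : rest 0 ≡ (xc (at m) ℤ.- 1ℤ , yc (at m))
    rest-start = trans west (move-η (at m) W)

    rest-end : rest l ≡ at len
    rest-end = cong at (ℕP.m∸n+n≡m m<n)

    rest-avoids : ∀ {i} → i ℕ.≤ m → Avoids (at i)
    rest-avoids {i} i≤m {j} j≤l eq =
      ℕP.<⇒≢ (ℕP.<-≤-trans (ℕ.s≤s i≤m) (ℕP.m≤n+m s j))
             (sym (injective (shift-≤ j≤l) (ℕP.≤-trans i≤m (ℕP.<⇒≤ m<n)) eq))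

    rest-north-clear : ∀ {j} → j ℕ.< l → crosses (xc (at m)) (rest j) (rest (suc j)) ≡ true →
      ¬ yc (at m) ℤ.< yc (rest j)
    rest-north-clear j<l c higher = clear (shift-≤ j<l) (c , higher)

    start-below : ∀ {c} → below c (rest 0) ≡ true → xc (at m) ≡ xc c ℤ.+ 1ℤ × yc (at m) ℤ.< yc c
    start-below {c} b with same-column , lower ← below-sound {c} b =
      trans (sym (i-1+1≡i (xc (at m)))) (cong (ℤ._+ 1ℤ) (trans (sym (cong xc rest-start)) same-column)) ,
      subst (ℤ._< yc c) (cong yc rest-start) lower

    end-not-below : ∀ {c} → xc c ℤ.< xc (at len) → below c (rest l) ≡ false
    end-not-below {c} c<end = ¬-not λ b →
      ℤP.<-irrefl (trans (sym (proj₁ (below-sound {c} {rest l} b))) (cong xc rest-end)) c<end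

    rayParity-east-step : ∀ {x y} → Avoids (x , y) → below (x , y) (rest 0) ≢ true →
      x ℤ.< xc (at len) → rayParity (x ℤ.+ 1ℤ , y) ≡ rayParity (x , y)
    rayParity-east-step avoids start-not-below x<end = sym (xor-false⇒≡
      (trans (rayParity-east avoids) (cong₂ _xor_ (¬-not start-not-below) (end-not-below x<end))))

    rayParityAt : ℕ → Bool
    rayParityAt i = rayParity (at i)

    rayParityAt-glue : rayParityAt m ≡ true
    rayParityAt-glue = begin
      rayParityAt m
        ≡⟨ rayParity-unblocked (rest-avoids ℕP.≤-refl) rest-north-clear ⟩
      (xc (rest 0) <ᵇ xc (at m)) xor (xc (rest l) <ᵇ xc (at m))
        ≡⟨ cong₂ _xor_ start-west end-east ⟩
      true ∎
      where
      start-west : (xc (rest 0) <ᵇ xc (at m)) ≡ true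
      start-west = dec-true (xc (rest 0) ℤ.<? xc (at m))
        (subst (ℤ._< xc (at m)) (sym (cong xc rest-start)) (i-1<i (xc (at m))))
      end-east : (xc (rest l) <ᵇ xc (at m)) ≡ false
      end-east = dec-false (xc (rest l) ℤ.<? xc (at m))
        (ℤP.<-asym (subst (xc (at m) ℤ.<_) (sym (cong xc rest-end)) (east m<n)))

    rayParityAt-southClear : ∀ {k} → SouthClear k → rayParityAt k ≡ false
    rayParityAt-southClear south-clear =
      rayParity-clear λ j<l c lower → south-clear (shift-≤ j<l) (c , lower)

    rayParityAt-suc : ∀ {i} → i ℕ.< m → rayParityAt (suc i) ≡ rayParityAt i
    rayParityAt-suc {i} i<m = by-direction (proj₁ st) (trans (proj₂ st) (move-η (at i) (proj₁ st)))
      where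
      i<n = ℕP.<-trans i<m m<n
      st  = step i<n
      x y : ℤ
      x = xc (at i)
      y = yc (at i)
      blocked : ∀ {v} → Crossing (xc (at m)) (x , y) v → at (suc i) ≡ v → ¬ yc (at m) ℤ.< y
      blocked crossing eq higher =
        clear i<n (crosses-complete (subst (Crossing _ (at i)) (sym eq) crossing) , higher)
      by-direction : ∀ d → at (suc i) ≡ move (x , y) d → rayParityAt (suc i) ≡ rayParityAt i
      by-direction N eq = trans (cong rayParity eq) (rayParity-north (rest-avoids (ℕP.<⇒≤ i<m)))
      by-direction S eq = begin
        rayParityAt (suc i)               ≡⟨ cong rayParity eq ⟩
        rayParity (x , y ℤ.- 1ℤ)          ≡⟨ rayParity-north (subst Avoids eq (rest-avoids i<m)) ⟨
        rayParity (x , y ℤ.- 1ℤ ℤ.+ 1ℤ)   ≡⟨ cong (λ y′ → rayParity (x , y′)) (i-1+1≡i y) ⟩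
        rayParityAt i                     ∎
      by-direction E eq = trans (cong rayParity eq)
        (rayParity-east-step (rest-avoids (ℕP.<⇒≤ i<m)) start-not-below (east i<n))
        where
        start-not-below : below (x , y) (rest 0) ≢ true
        start-not-below b with east-end , higher ← start-below b =
          blocked (eastward (sym east-end)) eq higher
      by-direction W eq = begin
        rayParityAt (suc i)               ≡⟨ cong rayParity eq ⟩
        rayParity (x ℤ.- 1ℤ , y)          ≡⟨ rayParity-east-step (subst Avoids eq (rest-avoids i<m))
                                               start-not-below (ℤP.<-trans (i-1<i x) (east i<n)) ⟨
        rayParity (x ℤ.- 1ℤ ℤ.+ 1ℤ , y)   ≡⟨ cong (λ x′ → rayParity (x′ , y)) (i-1+1≡i x) ⟩
        rayParityAt i                     ∎
        where
        start-not-below : below (x ℤ.- 1ℤ , y) (rest 0) ≢ true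
        start-not-below b with east-end , higher ← start-below b =
          blocked (westward (trans (sym (i-1+1≡i x)) (sym east-end))) eq higher

    rayParityAt-constant : ∀ t {i} → i ℕ.+ t ≡ m → rayParityAt i ≡ rayParityAt m
    rayParityAt-constant zero    {i} i+0≡m = cong rayParityAt (trans (sym (ℕP.+-identityʳ i)) i+0≡m)
    rayParityAt-constant (suc t) {i} i+t+1≡m =
      trans (sym (rayParityAt-suc i<m)) (rayParityAt-constant t (trans (sym (ℕP.+-suc i t)) i+t+1≡m))
      where
      i<m : i ℕ.< m
      i<m = subst (i ℕ.<_) i+t+1≡m (ℕP.m<m+n i ℕ.z<s)

    south-not-clear : ∀ {k} → k ℕ.≤ m → ¬ SouthClear k
    south-not-clear {k} k≤m south-clear with () ← begin
      true           ≡⟨ rayParityAt-glue ⟨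
      rayParityAt m  ≡⟨ rayParityAt-constant (m ℕ.∸ k) (ℕP.m+[n∸m]≡n k≤m) ⟨
      rayParityAt k  ≡⟨ rayParityAt-southClear south-clear ⟩
      false          ∎

  north-then-south-clear-impossible : ∀ {k m} → k ℕ.≤ m → m ℕ.< len →
    WestStep m → NorthClear m → SouthClear k → ⊥
  north-then-south-clear-impossible k≤m m<n west clear =
    AfterWestStep.south-not-clear m<n west clear k≤m

reflect : Pos → Pos
reflect (x , y) = (x , ℤ.- y)

reflect-injective : ∀ {u v} → reflect u ≡ reflect v → u ≡ v
reflect-injective {_ , _} {_ , _} eq =
  cong₂ _,_ (cong proj₁ eq) (ℤP.neg-injective (cong proj₂ eq))

reflect-step : ∀ {u v} → UnitStep u v → UnitStep (reflect u) (reflect v)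
reflect-step {x , y} (N , refl) = S , cong (x ,_) (ℤP.neg-distrib-+ y 1ℤ)
reflect-step {x , y} (S , refl) = N , cong (x ,_) (ℤP.neg-distrib-+ y (ℤ.- 1ℤ))
reflect-step {_ , _} (E , refl) = E , refl
reflect-step {_ , _} (W , refl) = W , refl

reflect-west : ∀ p → reflect (move p W) ≡ move (reflect p) W
reflect-west (_ , _) = refl

mirror : EastwardWalk → EastwardWalk
mirror w = record
  { len       = len
  ; at        = reflect ∘ at
  ; step      = reflect-step ∘ step
  ; injective = λ i≤n j≤n → injective i≤n j≤n ∘ reflect-injective
  ; east      = east
  }
  where open EastwardWalk w

module _ (w : EastwardWalk) where
  open EastwardWalk w

  clear-west-steps-impossible : ∀ {m k} → m ℕ.< len → k ℕ.< len → WestStep m → WestStep k →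
    NorthClear m → SouthClear k → ⊥
  clear-west-steps-impossible {m} {k} m<n k<n west-m west-k north-m south-k with k ℕP.≤? m
  ... | yes k≤m = north-then-south-clear-impossible w k≤m m<n west-m north-m south-k
  -- Reflecting in the x-axis swaps north and south, and reduces m < k to the case k ≤ m.
  ... | no  k≰m = north-then-south-clear-impossible (mirror w) (ℕP.<⇒≤ (ℕP.≰⇒> k≰m)) k<n
        (trans (cong reflect west-k) (reflect-west (at k)))
        (λ j<n (c , lower) → south-k j<n (c , ℤP.neg-cancel-< lower))
        (λ j<n (c , lower) → north-m j<n (c , ℤP.neg-cancel-< lower))

-- toℚ a is definitionally fromℚᵘ (mkℚᵘ a 0).
toℚ-mono-< : ∀ {a b} → a ℤ.< b → toℚ a ℚ.< toℚ b
toℚ-mono-< {a} {b} a<b = ℚP.toℚᵘ-cancel-<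
  (ℚᵘP.<-respˡ-≃ (ℚᵘP.≃-sym (ℚP.toℚᵘ-fromℚᵘ (ℚᵘ.mkℚᵘ a 0)))
    (ℚᵘP.<-respʳ-≃ (ℚᵘP.≃-sym (ℚP.toℚᵘ-fromℚᵘ (ℚᵘ.mkℚᵘ b 0)))
      (ℚᵘ.*<* (subst₂ ℤ._<_ (sym (ℤP.*-identityʳ a)) (sym (ℤP.*-identityʳ b)) a<b))))

midpoint-onSegment : ∀ a b y → OnSegment ((a ℚ.+ b) ℚ.* ½ , y) (a , y) (b , y)
midpoint-onSegment a b y =
  ½ , ℚ.*≤* (ℤ.+≤+ ℕ.z≤n) , ℚ.*≤* (ℤ.+≤+ (ℕ.s≤s ℕ.z≤n)) , x-eq a b , y-eq y
  where
  open Data.Rational.Solver.+-*-Solver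
  x-eq : ∀ a b → (a ℚ.+ b) ℚ.* ½ ≡ a ℚ.+ ½ ℚ.* (b ℚ.- a)
  x-eq = solve 2 (λ a b → (a :+ b) :* con ½ := a :+ con ½ :* (b :- a)) refl
  y-eq : ∀ y → y ≡ y ℚ.+ ½ ℚ.* (y ℚ.- y)
  y-eq = solve 1 (λ y → y := y :+ con ½ :* (y :- y)) refl

crossing-on-ray : ∀ {h u v} → Crossing h u v →
  OnSegment ((toℚ h ℚ.+ toℚ (h ℤ.- 1ℤ)) ℚ.* ½ , toℚ (yc u)) (embed u) (embed v)
crossing-on-ray (eastward {x} {y} refl) =
  subst (λ a → OnSegment (a , toℚ y) (embed (x , y)) (embed (x ℤ.+ 1ℤ , y))) midpoints-agree
    (midpoint-onSegment (toℚ x) (toℚ (x ℤ.+ 1ℤ)) (toℚ y))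
  where
  midpoints-agree : (toℚ x ℚ.+ toℚ (x ℤ.+ 1ℤ)) ℚ.* ½
                  ≡ (toℚ (x ℤ.+ 1ℤ) ℚ.+ toℚ (x ℤ.+ 1ℤ ℤ.- 1ℤ)) ℚ.* ½
  midpoints-agree = cong (ℚ._* ½) (trans (ℚP.+-comm (toℚ x) (toℚ (x ℤ.+ 1ℤ)))
    (cong (λ z → toℚ (x ℤ.+ 1ℤ) ℚ.+ toℚ z) (sym (i+1-1≡i x))))
crossing-on-ray (westward {x} {y} refl) = midpoint-onSegment (toℚ x) (toℚ (x ℤ.- 1ℤ)) (toℚ y)

ray-north-hits : ∀ {a b c} (Hit : Point → Set) → b ℚ.< c → Hit (a , c) →
  Σ ℚ λ t → 0ℚ ℚ.< t × Hit (a , b ℚ.+ t)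
ray-north-hits {a} {b} {c} Hit b<c hit =
  c ℚ.- b , subst (ℚ._< c ℚ.- b) (ℚP.+-inverseʳ b) (ℚP.+-monoˡ-< (ℚ.- b) b<c) ,
  subst (λ y → Hit (a , y)) (c≡b+[c-b] b c) hit
  where
  open Data.Rational.Solver.+-*-Solver
  c≡b+[c-b] : ∀ b c → c ≡ b ℚ.+ (c ℚ.- b)
  c≡b+[c-b] = solve 2 (λ b c → c := b :+ (c :- b)) refl

ray-south-hits : ∀ {a b c} (Hit : Point → Set) → c ℚ.< b → Hit (a , c) →
  Σ ℚ λ t → 0ℚ ℚ.< t × Hit (a , b ℚ.- t)
ray-south-hits {a} {b} {c} Hit c<b hit =
  b ℚ.- c , subst (ℚ._< b ℚ.- c) (ℚP.+-inverseʳ c) (ℚP.+-monoˡ-< (ℚ.- c) c<b) ,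
  subst (λ y → Hit (a , y)) (c≡b-[b-c] b c) hit
  where
  open Data.Rational.Solver.+-*-Solver
  c≡b-[b-c] : ∀ b c → c ≡ b ℚ.- (b ℚ.- c)
  c≡b-[b-c] = solve 2 (λ b c → c := b :- (b :- c)) refl

findPos-hit : ∀ {k} (f : Fin k → Pos) (g : Fin k → TileType) i →
  Σ TileType λ t → findPos f g (f i) ≡ just t
findPos-hit f g zero with f zero ≟Pos f zero
... | yes _    = g zero , refl
... | no f0≢f0 = ⊥-elim (f0≢f0 refl)
findPos-hit f g (suc i) with f zero ≟Pos f (suc i)
... | yes _ = g zero , refl
... | no _  = findPos-hit (f ∘ suc) (g ∘ suc) i

∪P-covers : ∀ {n} σ′ (P : Path n) i → Σ TileType λ t → (σ′ ∪P P) (pos P i) ≡ just t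
∪P-covers σ′ P i with findPos (pos P) (tt P) (pos P i) | findPos-hit (pos P) (tt P) i
... | just t  | _      = t , refl
... | nothing | _ , ()

module _ {n} (P : Path n) where

  -- Only indices ≤ n are ever used; beyond n, vertex repeats the last tile.
  clamp : ℕ → Fin (suc n)
  clamp i = fromℕ< (ℕ.s≤s (ℕP.m⊓n≤n i n))

  toℕ-clamp : ∀ {i} → i ℕ.≤ n → toℕ (clamp i) ≡ i
  toℕ-clamp i≤n = trans (FinP.toℕ-fromℕ< _) (ℕP.m≤n⇒m⊓n≡m i≤n)

  vertex : ℕ → Pos
  vertex i = pos P (clamp i)

  vertex-toℕ : ∀ {i} (x : Fin (suc n)) → toℕ x ≡ i → vertex i ≡ pos P x
  vertex-toℕ x refl = cong (pos P) (FinP.toℕ-injective (toℕ-clamp (FinP.toℕ≤pred[n] x)))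

  vertex-inject₁ : (j : Fin n) → vertex (toℕ j) ≡ pos P (inject₁ j)
  vertex-inject₁ j = vertex-toℕ (inject₁ j) (FinP.toℕ-inject₁ j)

  vertex-suc : (j : Fin n) → vertex (suc (toℕ j)) ≡ pos P (suc j)
  vertex-suc j = vertex-toℕ (suc j) refl

  vertex-last : vertex n ≡ pos P lastIx
  vertex-last = vertex-toℕ lastIx (FinP.toℕ-fromℕ n)

  vertex-injective : ∀ {i j} → i ℕ.≤ n → j ℕ.≤ n → vertex i ≡ vertex j → i ≡ j
  vertex-injective i≤n j≤n eq =
    trans (sym (toℕ-clamp i≤n)) (trans (cong toℕ (distinct P eq)) (toℕ-clamp j≤n))

  vertex-glue : (j : Fin n) → vertex (suc (toℕ j)) ≡ move (vertex (toℕ j)) (dir P j)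
  vertex-glue j = begin
    vertex (suc (toℕ j))               ≡⟨ vertex-suc j ⟩
    pos P (suc j)                      ≡⟨ adjacent P j ⟩
    move (pos P (inject₁ j)) (dir P j) ≡⟨ cong (λ p → move p (dir P j)) (vertex-inject₁ j) ⟨
    move (vertex (toℕ j)) (dir P j)    ∎

  vertex-step : ∀ {j} → j ℕ.< n → UnitStep (vertex j) (vertex (suc j))
  vertex-step {j} j<n = dir P g ,
    subst (λ i → vertex (suc i) ≡ move (vertex i) (dir P g)) (FinP.toℕ-fromℕ< j<n) (vertex-glue g)
    where g = fromℕ< j<n

  onEmbedding-step : ∀ {j r} → j ℕ.< n → OnSegment r (embed (vertex j)) (embed (vertex (suc j))) →
    OnEmbedding P r
  onEmbedding-step {j} {r} j<n segment = inj₂ (g , subst₂ (λ u v → OnSegment r (embed u) (embed v))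
    (trans (cong vertex (sym (FinP.toℕ-fromℕ< j<n))) (vertex-inject₁ g))
    (trans (cong (vertex ∘ suc) (sym (FinP.toℕ-fromℕ< j<n))) (vertex-suc g)) segment)
    where g = fromℕ< j<n

  vertex-east : ∀ {σ′} → LastUniqueEasternmost σ′ P →
    ∀ {i} → i ℕ.< n → xc (vertex i) ℤ.< xc (vertex n)
  vertex-east {σ′} easternmost {i} i<n = subst (λ p → xc (vertex i) ℤ.< xc p) (sym vertex-last)
    (easternmost (vertex i) _ (proj₂ (∪P-covers σ′ P (clamp i))) not-last)
    where
    not-last : vertex i ≢ pos P lastIx
    not-last eq = ℕP.<⇒≢ i<n (vertex-injective (ℕP.<⇒≤ i<n) ℕP.≤-refl (trans eq (sym vertex-last)))

  pathWalk : ∀ {σ′} → LastUniqueEasternmost σ′ P → EastwardWalk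
  pathWalk easternmost = record
    { len       = n
    ; at        = vertex
    ; step      = vertex-step
    ; injective = vertex-injective
    ; east      = vertex-east easternmost
    }

  west-rayStart : (m : Fin n) → dir P m ≡ W →
    rayStart P m ≡ ((toℚ (xc (vertex (toℕ m))) ℚ.+ toℚ (xc (vertex (toℕ m)) ℤ.- 1ℤ)) ℚ.* ½ ,
                    toℚ (yc (vertex (toℕ m))))
  west-rayStart m west =
    cong₂ (λ p q → ((toℚ (xc p) ℚ.+ toℚ (xc q)) ℚ.* ½ , toℚ (yc p)))
          (sym (vertex-inject₁ m)) (begin
      pos P (suc m)                          ≡⟨ vertex-suc m ⟨
      vertex (suc (toℕ m))                   ≡⟨ vertex-glue m ⟩
      move (vertex (toℕ m)) (dir P m)        ≡⟨ cong (move (vertex (toℕ m))) west ⟩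
      move (vertex (toℕ m)) W                ≡⟨ move-η (vertex (toℕ m)) W ⟩
      (xc (vertex (toℕ m)) ℤ.- 1ℤ , yc (vertex (toℕ m))) ∎)

  east-unless-west : ∀ {m} → Horizontal P m → dir P m ≢ W → PointsEast P m
  east-unless-west (inj₁ east) _        = east
  east-unless-west (inj₂ west) not-west = ⊥-elim (not-west west)

  module _ {σ′ : Assembly} (easternmost : LastUniqueEasternmost σ′ P) where
    open EastwardWalk (pathWalk easternmost)

    west-glue-step : (m : Fin n) → dir P m ≡ W → WestStep (toℕ m)
    west-glue-step m west = trans (vertex-glue m) (cong (move (vertex (toℕ m))) west)

    west-ray-meets : (m : Fin n) → dir P m ≡ W → ∀ {j} → j ℕ.< n →
      crosses (xc (vertex (toℕ m))) (vertex j) (vertex (suc j)) ≡ true →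
      OnEmbedding P (proj₁ (rayStart P m) , toℚ (yc (vertex j)))
    west-ray-meets m west {j} j<n c = onEmbedding-step j<n
      (subst (λ a → OnSegment (a , toℚ (yc (vertex j))) (embed (vertex j)) (embed (vertex (suc j))))
        (sym (cong proj₁ (west-rayStart m west)))
        (crossing-on-ray (crosses-sound (vertex-step j<n) c)))

    visibleNorth⇒northClear : (m : Fin n) → dir P m ≡ W → VisibleNorth σ′ P m → NorthClear (toℕ m)
    visibleNorth⇒northClear m west visible j<n (c , lower) = visible
      (ray-north-hits (λ r → OnEmbedding P r ⊎ OnSeed σ′ r)
        (subst (ℚ._< _) (sym (cong proj₂ (west-rayStart m west))) (toℚ-mono-< lower))
        (inj₁ (west-ray-meets m west j<n c)))

    visibleSouth⇒southClear : (m : Fin n) → dir P m ≡ W → VisibleSouth σ′ P m → SouthClear (toℕ m)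
    visibleSouth⇒southClear m west visible j<n (c , higher) = visible
      (ray-south-hits (λ r → OnEmbedding P r ⊎ OnSeed σ′ r)
        (subst (_ ℚ.<_) (sym (cong proj₂ (west-rayStart m west))) (toℚ-mono-< higher))
        (inj₁ (west-ray-meets m west j<n c)))

lemma3 : (𝒯 : TAS) (n : ℕ) (P : Path n) →
    ProduciblePath 𝒯 P →
    LastUniqueEasternmost (σ 𝒯) P →
    (∀ m → Horizontal P m → VisibleNorth (σ 𝒯) P m → PointsEast P m) ⊎
    (∀ m → Horizontal P m → VisibleSouth (σ 𝒯) P m → PointsEast P m)
lemma3 𝒯 n P _ easternmost = split (ℕP.anyUpTo? (λ m → westStep? m ×-dec northClear? m) n)
  where
  open EastwardWalk (pathWalk P easternmost)

  split : Dec (Σ ℕ λ m → m ℕ.< n × WestStep m × NorthClear m) →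
    (∀ m → Horizontal P m → VisibleNorth (σ 𝒯) P m → PointsEast P m) ⊎
    (∀ m → Horizontal P m → VisibleSouth (σ 𝒯) P m → PointsEast P m)
  split (yes (m , m<n , m-west , m-clear)) = inj₂ λ k horizontal visible →
    east-unless-west P horizontal λ k-west →
      clear-west-steps-impossible (pathWalk P easternmost) m<n (FinP.toℕ<n k) m-west
        (west-glue-step P easternmost k k-west) m-clear
        (visibleSouth⇒southClear P easternmost k k-west visible)
  split (no none) = inj₁ λ m horizontal visible →
    east-unless-west P horizontal λ m-west →
      none (toℕ m , FinP.toℕ<n m , west-glue-step P easternmost m m-west ,
            visibleNorth⇒northClear P easternmost m m-west visible)
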